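{- Let $p$ be an odd prime and let $a$ be an integer with $1<a<p$. Then there exists a family $A_1,\dots,A_{(p-1)/2}$ of sequences in $\{+1,-1\}^p$, each having exactly $a$ entries equal to $+1$, which is a $PComS\left(p,\frac{p-1}{2},\,2a(a-p)+\frac{p(p-1)}{2}\right)$, i.e. $$\sum_{i=1}^{(p-1)/2}\mathsf{P}_{A_i}(k)=2a(a-p)+\frac{p(p-1)}{2}\quad\text{for all }1\le k\le p-1.$$
   Context: The periodic autocorrelation of $X=(x_0,\dots,x_{n-1})\in\{\pm1\}^n$ at shift $k$ is $\mathsf{P}_X(k)=\sum_{i=0}^{n-1}x_ix_{(i+k)\bmod n}$. A family $A_1,\dots,A_q\in\{\pm1\}^n$ is a $PComS(n,q,c)$ if $\sum_{i=1}^q\mathsf{P}_{A_i}(k)=c$ for all $1\le k\le n-1$. -}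

module Defs where

open import Data.Nat as ℕ using (ℕ; zero; suc; NonZero)
open import Data.Nat.DivMod using (_mod_)
open import Data.Fin using (Fin; toℕ)
open import Data.Integer as ℤ using (ℤ)
open import Data.Sign using (Sign)
open import Relation.Binary.PropositionalEquality using (_≡_)

PMSeq : ℕ → Set
PMSeq n = Fin n → Sign

sgn : Sign → ℤ
sgn Sign.+ = ℤ.+ 1
sgn Sign.- = ℤ.-[1+ 0 ]

sumℤ : {n : ℕ} → (Fin n → ℤ) → ℤ
sumℤ {zero} f = ℤ.+ 0
sumℤ {suc n} f = f Data.Fin.zero ℤ.+ sumℤ {n} (λ i → f (Data.Fin.suc i))

countPlus : {n : ℕ} → PMSeq n → ℕ
countPlus {zero} x = 0
countPlus {suc n} x with x Data.Fin.zero
... | Sign.+ = suc (countPlus {n} (λ i → x (Data.Fin.suc i)))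
... | Sign.- = countPlus {n} (λ i → x (Data.Fin.suc i))

PAC : (n : ℕ) → .{{_ : NonZero n}} → PMSeq n → ℕ → ℤ
PAC n x k = sumℤ {n} (λ i → sgn (x i) ℤ.* sgn (x ((toℕ i ℕ.+ k) mod n)))

IsPComS : (n : ℕ) → .{{_ : NonZero n}} → (q : ℕ) → ℤ → (Fin q → PMSeq n) → Set
IsPComS n q c A = (k : ℕ) → 1 ℕ.≤ k → k ℕ.≤ n ℕ.∸ 1 →
  sumℤ {q} (λ j → PAC n (A j) k) ≡ c

module Submission where

-- Let h = (p - 1)/2 and let g be the sign pattern of the "interval"
-- {0, …, a - 1} in ℤ_p: g(y) = +1 for y < a and g(y) = -1 otherwise.
-- Take A_j(i) = g(j·i) for j = 1, …, h.  Since i ↦ j·i permutes ℤ_p,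
-- every A_j has exactly a entries +1, and its autocorrelation at shift k
-- is C(j·k), where C(c) = ∑_x g(x) g(x + c) is the periodic correlation
-- of g.  As C(-c) = C(c) and ±j·k (1 ≤ j ≤ h) runs over all non-zero
-- residues, 2 ∑_j P_{A_j}(k) = ∑_{c ≠ 0} C(c) = (∑ g)² - C(0)
-- = (2a - p)² - p, which is twice 2a(a - p) + p(p - 1)/2.

open import Defs
open import Data.Nat as ℕ using (ℕ; zero; suc; NonZero; _<_; _≤_; _∸_; _%_; _/_)
import Data.Nat.Properties as ℕP
open import Data.Nat.DivMod using (_mod_; m≡m%n+[m/n]*n; m%n%n≡m%n; m%n<n; m<n⇒m%n≡m; %-distribˡ-+; %-distribˡ-*; %-remove-+ʳ; m*n/n≡m)
open import Data.Nat.Divisibility using (_∣_; divides; divides-refl; ∣m+n∣m⇒∣n; >⇒∤; m∣m*n)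
open import Data.Nat.Coprimality as Coprimality using (Coprime; coprime-divisor; 1-coprimeTo; prime⇒coprime)
open import Data.Nat.Primality using (Prime; prime⇒nonZero)
import Data.Nat.Tactic.RingSolver as ℕSolver
open import Data.Integer as ℤ using (ℤ; +_; _+_; _-_; _*_; -_)
import Data.Integer.Properties as ℤP
open import Data.Integer.Tactic.RingSolver using (solve-∀)
open import Data.Sign using (Sign)
open import Data.Fin using (Fin; toℕ; punchOut) renaming (zero to fz; suc to fs)
open import Data.Fin.Properties using (toℕ<n; toℕ-fromℕ<; toℕ-injective; any?; _≟_; punchOut-injective; injective⇒≤)
open import Data.Fin.Permutation using (Permutation; permutation)
open import Algebra.Properties.Semiring.Sum ℤP.+-*-semiring using (sum; sum-cong-≗; ∑-comm; *-distribˡ-sum; *-distribʳ-sum; sum-permute)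
open import Data.Product using (Σ; ∃; _×_; _,_; proj₁; proj₂)
open import Data.Sum using (inj₁; inj₂)
open import Function.Definitions using (Injective)
open import Relation.Nullary using (yes; no; contradiction)
open import Relation.Binary.PropositionalEquality using (_≡_; refl; sym; trans; cong; cong₂; subst; module ≡-Reasoning)

open ≡-Reasoning

-- Sums over initial segments of ℕ.

-- ∑< n f = f 0 + f 1 + ⋯ + f (n - 1).  It is defined through sumℤ, so an
-- autocorrelation PAC (a sum over Fin n) is literally a sum of this form.
∑< : ℕ → (ℕ → ℤ) → ℤ
∑< n f = sumℤ {n} (λ i → f (toℕ i))

sumℤ≡sum : ∀ {n} (f : Fin n → ℤ) → sumℤ f ≡ sum f
sumℤ≡sum {zero} f = refl
sumℤ≡sum {suc n} f = cong (λ s → f fz + s) (sumℤ≡sum (λ i → f (fs i)))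

sumℤ-cong : ∀ {n} {f g : Fin n → ℤ} → (∀ i → f i ≡ g i) → sumℤ f ≡ sumℤ g
sumℤ-cong {f = f} {g} e = trans (sumℤ≡sum f) (trans (sum-cong-≗ e) (sym (sumℤ≡sum g)))

∑<-cong : ∀ n {f g : ℕ → ℤ} → (∀ i → i < n → f i ≡ g i) → ∑< n f ≡ ∑< n g
∑<-cong n e = sumℤ-cong (λ i → e (toℕ i) (toℕ<n i))

∑<-const : ∀ n c → ∑< n (λ _ → c) ≡ + n * c
∑<-const zero c = sym (ℤP.*-zeroˡ c)
∑<-const (suc n) c = trans (cong (λ s → c + s) (∑<-const n c)) (sym (ℤP.suc-* (+ n) c))

∑<-split : ∀ m n (f : ℕ → ℤ) → ∑< (m ℕ.+ n) f ≡ ∑< m f + ∑< n (λ i → f (m ℕ.+ i))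
∑<-split zero n f = sym (ℤP.+-identityˡ _)
∑<-split (suc m) n f =
  trans (cong (λ s → f 0 + s) (∑<-split m n (λ i → f (suc i)))) (sym (ℤP.+-assoc (f 0) _ _))

∑<-snoc : ∀ n (f : ℕ → ℤ) → ∑< (suc n) f ≡ ∑< n f + f n
∑<-snoc n f = begin
  ∑< (suc n) f                  ≡⟨ cong (λ m → ∑< m f) (ℕP.+-comm 1 n) ⟩
  ∑< (n ℕ.+ 1) f                ≡⟨ ∑<-split n 1 f ⟩
  ∑< n f + (f (n ℕ.+ 0) + + 0)  ≡⟨ cong (λ s → ∑< n f + s) (ℤP.+-identityʳ _) ⟩
  ∑< n f + f (n ℕ.+ 0)          ≡⟨ cong (λ m → ∑< n f + f m) (ℕP.+-identityʳ n) ⟩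
  ∑< n f + f n                  ∎

∑<-reverse : ∀ n (f : ℕ → ℤ) → ∑< n f ≡ ∑< n (λ i → f (n ∸ suc i))
∑<-reverse zero f = refl
∑<-reverse (suc n) f = begin
  ∑< (suc n) f                      ≡⟨ ∑<-snoc n f ⟩
  ∑< n f + f n                      ≡⟨ cong (_+ f n) (∑<-reverse n f) ⟩
  ∑< n (λ i → f (n ∸ suc i)) + f n  ≡⟨ ℤP.+-comm _ (f n) ⟩
  f n + ∑< n (λ i → f (n ∸ suc i))  ∎

∑<-*ˡ : ∀ n c (f : ℕ → ℤ) → ∑< n (λ i → c * f i) ≡ c * ∑< n f
∑<-*ˡ n c f = begin
  ∑< n (λ i → c * f i)           ≡⟨ sumℤ≡sum {n} (λ i → c * f (toℕ i)) ⟩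
  sum {n} (λ i → c * f (toℕ i))  ≡⟨ sym (*-distribˡ-sum {n} c (λ i → f (toℕ i))) ⟩
  c * sum {n} (λ i → f (toℕ i))  ≡⟨ cong (λ s → c * s) (sym (sumℤ≡sum {n} (λ i → f (toℕ i)))) ⟩
  c * ∑< n f                     ∎

∑<-*ʳ : ∀ n c (f : ℕ → ℤ) → ∑< n (λ i → f i * c) ≡ ∑< n f * c
∑<-*ʳ n c f = begin
  ∑< n (λ i → f i * c)           ≡⟨ sumℤ≡sum {n} (λ i → f (toℕ i) * c) ⟩
  sum {n} (λ i → f (toℕ i) * c)  ≡⟨ sym (*-distribʳ-sum {n} c (λ i → f (toℕ i))) ⟩
  sum {n} (λ i → f (toℕ i)) * c  ≡⟨ cong (_* c) (sym (sumℤ≡sum {n} (λ i → f (toℕ i)))) ⟩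
  ∑< n f * c                     ∎

∑<-swap : ∀ m n (f : ℕ → ℕ → ℤ) →
  ∑< m (λ i → ∑< n (f i)) ≡ ∑< n (λ j → ∑< m (λ i → f i j))
∑<-swap m n f = begin
  ∑< m (λ i → ∑< n (f i))                   ≡⟨ sumℤ≡sum {m} (λ i → ∑< n (f (toℕ i))) ⟩
  sum {m} (λ i → ∑< n (f (toℕ i)))          ≡⟨ sum-cong-≗ (λ i → sumℤ≡sum {n} (F i)) ⟩
  sum {m} (λ i → sum {n} (λ j → F i j))     ≡⟨ ∑-comm F ⟩
  sum {n} (λ j → sum {m} (λ i → F i j))     ≡⟨ sum-cong-≗ (λ j → sym (sumℤ≡sum {m} (λ i → F i j))) ⟩
  sum {n} (λ j → ∑< m (λ i → f i (toℕ j)))  ≡⟨ sym (sumℤ≡sum {n} (λ j → ∑< m (λ i → f i (toℕ j)))) ⟩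
  ∑< n (λ j → ∑< m (λ i → f i j))           ∎
  where
  F : Fin m → Fin n → ℤ
  F i j = f (toℕ i) (toℕ j)

∑<-fold : ∀ h (F : ℕ → ℤ) → (∀ s t → s ℕ.+ t ≡ suc (h ℕ.+ h) → F s ≡ F t) →
  ∑< (suc (h ℕ.+ h)) F ≡ F 0 + (∑< h (λ j → F (suc j)) + ∑< h (λ j → F (suc j)))
∑<-fold h F symmetric = cong (λ s → F 0 + s) (begin
  ∑< (h ℕ.+ h) (λ t → F (suc t))                ≡⟨ ∑<-split h h (λ t → F (suc t)) ⟩
  T + ∑< h (λ i → F (suc (h ℕ.+ i)))            ≡⟨ cong (λ s → T + s) (∑<-reverse h (λ i → F (suc (h ℕ.+ i)))) ⟩
  T + ∑< h (λ i → F (suc (h ℕ.+ (h ∸ suc i))))  ≡⟨ cong (λ s → T + s) (∑<-cong h mirror) ⟩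
  T + T                                         ∎)
  where
  T = ∑< h (λ j → F (suc j))
  mirror : ∀ i → i < h → F (suc (h ℕ.+ (h ∸ suc i))) ≡ F (suc i)
  mirror i i<h = symmetric _ _ (begin
    suc (h ℕ.+ (h ∸ suc i)) ℕ.+ suc i  ≡⟨ cong suc (ℕP.+-assoc h (h ∸ suc i) (suc i)) ⟩
    suc (h ℕ.+ (h ∸ suc i ℕ.+ suc i))  ≡⟨ cong (λ r → suc (h ℕ.+ r)) (ℕP.m∸n+n≡m i<h) ⟩
    suc (h ℕ.+ h)                      ∎)

injective⇒surjective : ∀ {n} (f : Fin n → Fin n) → Injective _≡_ _≡_ f →
  ∀ y → ∃ λ x → f x ≡ y
injective⇒surjective {suc n} f f-inj y with any? (λ x → f x ≟ y)
... | yes hit = hit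
... | no miss = contradiction (injective⇒≤ squeeze-inj) (ℕP.<-irrefl refl)
  where
  -- f misses y, so it squeezes Fin (1 + n) injectively into Fin n
  squeeze : Fin (suc n) → Fin n
  squeeze x = punchOut {i = y} {j = f x} (λ e → miss (x , sym e))
  squeeze-inj : Injective _≡_ _≡_ squeeze
  squeeze-inj {x} {x′} e =
    f-inj (punchOut-injective (λ e′ → miss (x , sym e′)) (λ e′ → miss (x′ , sym e′)) e)

sumℤ-reindex : ∀ {n} (f : Fin n → ℤ) {π : Fin n → Fin n} → Injective _≡_ _≡_ π →
  sumℤ (λ i → f (π i)) ≡ sumℤ f
sumℤ-reindex {n} f {π} π-inj =
  trans (sumℤ≡sum (λ i → f (π i))) (trans (sym (sum-permute f perm)) (sym (sumℤ≡sum f)))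
  where
  preimage : ∀ y → ∃ λ x → π x ≡ y
  preimage = injective⇒surjective π π-inj
  perm : Permutation n n
  perm = permutation π (λ y → proj₁ (preimage y)) (λ y → proj₂ (preimage y))
    (λ x → π-inj (proj₂ (preimage (π x))))

-- Sums over ℤ_n.

module Residues (n : ℕ) .{{_ : NonZero n}} where

  Periodic : (ℕ → ℤ) → Set
  Periodic F = ∀ {y z} → y % n ≡ z % n → F y ≡ F z

  +-cong-mod : ∀ {w x y z} → w % n ≡ x % n → y % n ≡ z % n → (w ℕ.+ y) % n ≡ (x ℕ.+ z) % n
  +-cong-mod {w} {x} {y} {z} e₁ e₂ = trans (%-distribˡ-+ w y n)
    (trans (cong₂ (λ u v → (u ℕ.+ v) % n) e₁ e₂) (sym (%-distribˡ-+ x z n)))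

  *-cong-mod : ∀ {w x y z} → w % n ≡ x % n → y % n ≡ z % n → (w ℕ.* y) % n ≡ (x ℕ.* z) % n
  *-cong-mod {w} {x} {y} {z} e₁ e₂ = trans (%-distribˡ-* w y n)
    (trans (cong₂ (λ u v → (u ℕ.* v) % n) e₁ e₂) (sym (%-distribˡ-* x z n)))

  %-idem : ∀ y → (y % n) % n ≡ y % n
  %-idem y = m%n%n≡m%n y n

  toℕ-mod : ∀ y → toℕ (y mod n) ≡ y % n
  toℕ-mod y = toℕ-fromℕ< (m%n<n y n)

  %-stable⇒∣ : ∀ u e → (u ℕ.+ e) % n ≡ u % n → n ∣ e
  %-stable⇒∣ u e eq = ∣m+n∣m⇒∣n (divides ((u ℕ.+ e) / n) quotients) (divides-refl (u / n))
    where
    quotients : (u / n) ℕ.* n ℕ.+ e ≡ ((u ℕ.+ e) / n) ℕ.* n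
    quotients = ℕP.+-cancelˡ-≡ (u % n) _ _ (begin
      u % n ℕ.+ ((u / n) ℕ.* n ℕ.+ e)          ≡⟨ sym (ℕP.+-assoc (u % n) _ e) ⟩
      u % n ℕ.+ (u / n) ℕ.* n ℕ.+ e            ≡⟨ cong (ℕ._+ e) (sym (m≡m%n+[m/n]*n u n)) ⟩
      u ℕ.+ e                                  ≡⟨ m≡m%n+[m/n]*n (u ℕ.+ e) n ⟩
      (u ℕ.+ e) % n ℕ.+ ((u ℕ.+ e) / n) ℕ.* n  ≡⟨ cong (ℕ._+ ((u ℕ.+ e) / n) ℕ.* n) eq ⟩
      u % n ℕ.+ ((u ℕ.+ e) / n) ℕ.* n          ∎)

  -- The ordered case of injectivity: m·(x + d) + c ≡ m·x + c forces
  -- n ∣ m·d, hence n ∣ d, and then d = 0 because d < n.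
  affine-injective-≤ : ∀ {m} c → Coprime n m → ∀ {x y} → x ≤ y → y < n →
    (m ℕ.* x ℕ.+ c) % n ≡ (m ℕ.* y ℕ.+ c) % n → x ≡ y
  affine-injective-≤ {m} c coprime {x} x≤y y<n eq with ℕP.m≤n⇒∃[o]m+o≡n x≤y
  ... | zero , refl = sym (ℕP.+-identityʳ x)
  ... | suc d , refl = contradiction n∣1+d (>⇒∤ (ℕP.≤-<-trans (ℕP.m≤n+m (suc d) x) y<n))
    where
    shift : ∀ m x e c → m ℕ.* (x ℕ.+ e) ℕ.+ c ≡ (m ℕ.* x ℕ.+ c) ℕ.+ m ℕ.* e
    shift = ℕSolver.solve-∀
    n∣1+d : n ∣ suc d
    n∣1+d = coprime-divisor coprime (%-stable⇒∣ (m ℕ.* x ℕ.+ c) (m ℕ.* suc d)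
      (trans (cong (_% n) (sym (shift m x (suc d) c))) (sym eq)))

  affine-injective : ∀ {m} c → Coprime n m → ∀ {x y} → x < n → y < n →
    (m ℕ.* x ℕ.+ c) % n ≡ (m ℕ.* y ℕ.+ c) % n → x ≡ y
  affine-injective c coprime {x} {y} x<n y<n eq with ℕP.≤-total x y
  ... | inj₁ x≤y = affine-injective-≤ c coprime x≤y y<n eq
  ... | inj₂ y≤x = sym (affine-injective-≤ c coprime y≤x x<n (sym eq))

  ∑<-affine : ∀ {m} c {F : ℕ → ℤ} → Coprime n m → Periodic F →
    ∑< n (λ i → F (m ℕ.* i ℕ.+ c)) ≡ ∑< n F
  ∑<-affine {m} c {F} coprime F-periodic = begin
    ∑< n (λ i → F (m ℕ.* i ℕ.+ c))    ≡⟨ sumℤ-cong (λ i → F-periodic (sym (%-idem (image i)))) ⟩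
    sumℤ {n} (λ i → F (image i % n))  ≡⟨ sumℤ-cong (λ i → cong F (sym (toℕ-mod (image i)))) ⟩
    sumℤ {n} (λ i → F (toℕ (π i)))    ≡⟨ sumℤ-reindex (λ i → F (toℕ i)) π-injective ⟩
    ∑< n F                            ∎
    where
    image : Fin n → ℕ
    image i = m ℕ.* toℕ i ℕ.+ c
    π : Fin n → Fin n
    π i = image i mod n
    π-injective : Injective _≡_ _≡_ π
    π-injective {i} {j} e = toℕ-injective (affine-injective c coprime (toℕ<n i) (toℕ<n j)
      (trans (sym (toℕ-mod (image i))) (trans (cong toℕ e) (toℕ-mod (image j)))))

  ∑<-dilate : ∀ {m} {F : ℕ → ℤ} → Coprime n m → Periodic F →
    ∑< n (λ i → F (m ℕ.* i)) ≡ ∑< n F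
  ∑<-dilate {m} {F} coprime F-periodic =
    trans (∑<-cong n (λ i _ → cong F (sym (ℕP.+-identityʳ (m ℕ.* i))))) (∑<-affine 0 coprime F-periodic)

  ∑<-translate : ∀ c {F : ℕ → ℤ} → Periodic F → ∑< n (λ i → F (i ℕ.+ c)) ≡ ∑< n F
  ∑<-translate c {F} F-periodic =
    trans (∑<-cong n (λ i _ → cong (λ x → F (x ℕ.+ c)) (sym (ℕP.*-identityˡ i))))
      (∑<-affine c (Coprimality.sym (1-coprimeTo n)) F-periodic)

-- The periodic correlation of a sign pattern on ℤ_n.

sgn-square : ∀ σ → sgn σ * sgn σ ≡ + 1
sgn-square Sign.+ = refl
sgn-square Sign.- = refl

module Correlation (n : ℕ) .{{_ : NonZero n}} (s : ℕ → Sign) where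
  open Residues n

  g : ℕ → ℤ
  g y = sgn (s (y % n))

  g-periodic : Periodic g
  g-periodic e = cong (λ r → sgn (s r)) e

  corr : ℕ → ℤ
  corr c = ∑< n (λ x → g x * g (x ℕ.+ c))

  lagged-periodic : ∀ c → Periodic (λ x → g x * g (x ℕ.+ c))
  lagged-periodic c e = cong₂ _*_ (g-periodic e) (g-periodic (+-cong-mod e refl))

  corr-periodic : Periodic corr
  corr-periodic e = ∑<-cong n (λ x _ → cong (λ v → g x * v) (g-periodic (+-cong-mod {x} refl e)))

  corr-zero : corr 0 ≡ + n
  corr-zero = begin
    ∑< n (λ x → g x * g (x ℕ.+ 0))  ≡⟨ ∑<-cong n (λ x _ → square x) ⟩
    ∑< n (λ _ → + 1)                ≡⟨ ∑<-const n (+ 1) ⟩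
    + n * + 1                       ≡⟨ ℤP.*-identityʳ (+ n) ⟩
    + n                             ∎
    where
    square : ∀ x → g x * g (x ℕ.+ 0) ≡ + 1
    square x = trans (cong (λ y → g x * g y) (ℕP.+-identityʳ x)) (sgn-square (s (x % n)))

  -- C(-c) = C(c): shifts adding up to a multiple of n have equal correlation.
  corr-sym : ∀ c d → n ∣ c ℕ.+ d → corr c ≡ corr d
  corr-sym c d n∣c+d = begin
    corr c                                        ≡⟨ sym (∑<-translate d (lagged-periodic c)) ⟩
    ∑< n (λ x → g (x ℕ.+ d) * g (x ℕ.+ d ℕ.+ c))  ≡⟨ ∑<-cong n (λ x _ → wrap x) ⟩
    corr d                                        ∎
    where
    -- x + d + c ≡ x (mod n), and the two factors then commute
    wrap : ∀ x → g (x ℕ.+ d) * g (x ℕ.+ d ℕ.+ c) ≡ g x * g (x ℕ.+ d)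
    wrap x = trans (cong (λ v → g (x ℕ.+ d) * v) (g-periodic (begin
        (x ℕ.+ d ℕ.+ c) % n    ≡⟨ cong (_% n) (ℕP.+-assoc x d c) ⟩
        (x ℕ.+ (d ℕ.+ c)) % n  ≡⟨ cong (λ r → (x ℕ.+ r) % n) (ℕP.+-comm d c) ⟩
        (x ℕ.+ (c ℕ.+ d)) % n  ≡⟨ %-remove-+ʳ x n∣c+d ⟩
        x % n                  ∎)))
      (ℤP.*-comm (g (x ℕ.+ d)) (g x))

  corr-total : ∑< n corr ≡ ∑< n g * ∑< n g
  corr-total = begin
    ∑< n (λ c → ∑< n (λ x → g x * g (x ℕ.+ c)))  ≡⟨ ∑<-swap n n (λ c x → g x * g (x ℕ.+ c)) ⟩
    ∑< n (λ x → ∑< n (λ c → g x * g (x ℕ.+ c)))  ≡⟨ ∑<-cong n (λ x _ → ∑<-*ˡ n (g x) (λ c → g (x ℕ.+ c))) ⟩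
    ∑< n (λ x → g x * ∑< n (λ c → g (x ℕ.+ c)))  ≡⟨ ∑<-cong n (λ x _ → cong (λ v → g x * v) (translated x)) ⟩
    ∑< n (λ x → g x * ∑< n g)                    ≡⟨ ∑<-*ʳ n (∑< n g) g ⟩
    ∑< n g * ∑< n g                              ∎
    where
    translated : ∀ x → ∑< n (λ c → g (x ℕ.+ c)) ≡ ∑< n g
    translated x = trans (∑<-cong n (λ c _ → cong g (ℕP.+-comm x c))) (∑<-translate x g-periodic)

  dilate : ℕ → PMSeq n
  dilate m i = s ((m ℕ.* toℕ i) % n)

  PAC-dilate : ∀ {m} k → Coprime n m → PAC n (dilate m) k ≡ corr (m ℕ.* k)
  PAC-dilate {m} k coprime = begin
    PAC n (dilate m) k                                  ≡⟨ sumℤ-cong {n} unfold ⟩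
    ∑< n (λ i → g (m ℕ.* i) * g (m ℕ.* i ℕ.+ m ℕ.* k))  ≡⟨ ∑<-dilate coprime (lagged-periodic (m ℕ.* k)) ⟩
    corr (m ℕ.* k)                                      ∎
    where
    wrap : ∀ i → (m ℕ.* toℕ ((i ℕ.+ k) mod n)) % n ≡ (m ℕ.* i ℕ.+ m ℕ.* k) % n
    wrap i = begin
      (m ℕ.* toℕ ((i ℕ.+ k) mod n)) % n  ≡⟨ cong (λ r → (m ℕ.* r) % n) (toℕ-mod (i ℕ.+ k)) ⟩
      (m ℕ.* ((i ℕ.+ k) % n)) % n        ≡⟨ *-cong-mod {m} refl (%-idem (i ℕ.+ k)) ⟩
      (m ℕ.* (i ℕ.+ k)) % n              ≡⟨ cong (_% n) (ℕP.*-distribˡ-+ m i k) ⟩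
      (m ℕ.* i ℕ.+ m ℕ.* k) % n          ∎
    unfold : ∀ i → sgn (dilate m i) * sgn (dilate m ((toℕ i ℕ.+ k) mod n))
                     ≡ g (m ℕ.* toℕ i) * g (m ℕ.* toℕ i ℕ.+ m ℕ.* k)
    unfold i = cong (λ v → g (m ℕ.* toℕ i) * v) (g-periodic (wrap (toℕ i)))

  -- For n = 2h + 1 and k a unit, the shifts j·k and -j·k (1 ≤ j ≤ h) run
  -- through all non-zero residues, so (∑ g)² = C(0) + 2 ∑_{j=1}^{h} C(j·k).
  corr-half-sum : ∀ {h k} → n ≡ suc (h ℕ.+ h) → Coprime n k →
    ∑< n g * ∑< n g ≡ + n + (∑< h (λ j → corr (suc j ℕ.* k)) + ∑< h (λ j → corr (suc j ℕ.* k)))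
  corr-half-sum {h} {k} n≡2h+1 coprime = begin
    ∑< n g * ∑< n g                            ≡⟨ sym corr-total ⟩
    ∑< n corr                                  ≡⟨ sym (∑<-dilate coprime corr-periodic) ⟩
    ∑< n (λ t → corr (k ℕ.* t))                ≡⟨ ∑<-cong n (λ t _ → cong corr (ℕP.*-comm k t)) ⟩
    ∑< n (λ t → corr (t ℕ.* k))                ≡⟨ cong (λ m → ∑< m (λ t → corr (t ℕ.* k))) n≡2h+1 ⟩
    ∑< (suc (h ℕ.+ h)) (λ t → corr (t ℕ.* k))  ≡⟨ ∑<-fold h (λ t → corr (t ℕ.* k)) opposite ⟩
    corr 0 + (T + T)                           ≡⟨ cong (_+ (T + T)) corr-zero ⟩
    + n + (T + T)                              ∎
    where
    T = ∑< h (λ j → corr (suc j ℕ.* k))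
    opposite : ∀ u v → u ℕ.+ v ≡ suc (h ℕ.+ h) → corr (u ℕ.* k) ≡ corr (v ℕ.* k)
    opposite u v u+v≡n = corr-sym (u ℕ.* k) (v ℕ.* k) (subst (n ∣_) n*k≡ (m∣m*n k))
      where
      n*k≡ : n ℕ.* k ≡ u ℕ.* k ℕ.+ v ℕ.* k
      n*k≡ = trans (cong (ℕ._* k) (trans n≡2h+1 (sym u+v≡n))) (ℕP.*-distribʳ-+ k u v)

sign-sum : ∀ {n} (x : PMSeq n) → + 2 * + countPlus x ≡ sumℤ (λ i → sgn (x i)) + + n
sign-sum {zero} x = refl
sign-sum {suc n} x with x fz | sign-sum (λ i → x (fs i))
... | Sign.+ | rest = plus-step _ (sumℤ (λ i → sgn (x (fs i)))) (+ n) rest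
  where
  plus-step : ∀ C R N → + 2 * C ≡ R + N → + 2 * (+ 1 + C) ≡ (+ 1 + R) + (+ 1 + N)
  plus-step C R N e = begin
    + 2 * (+ 1 + C)        ≡⟨ expand C ⟩
    + 2 + + 2 * C          ≡⟨ cong (λ v → + 2 + v) e ⟩
    + 2 + (R + N)          ≡⟨ regroup R N ⟩
    (+ 1 + R) + (+ 1 + N)  ∎
    where
    expand : ∀ C → + 2 * (+ 1 + C) ≡ + 2 + + 2 * C
    expand = solve-∀
    regroup : ∀ R N → + 2 + (R + N) ≡ (+ 1 + R) + (+ 1 + N)
    regroup = solve-∀
... | Sign.- | rest = trans rest (regroup (sumℤ (λ i → sgn (x (fs i)))) (+ n))
  where
  regroup : ∀ R N → R + N ≡ (- + 1 + R) + (+ 1 + N)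
  regroup = solve-∀

interval : ℕ → ℕ → Sign
interval a y with y ℕ.<? a
... | yes _ = Sign.+
... | no _ = Sign.-

interval-below : ∀ {a y} → y < a → interval a y ≡ Sign.+
interval-below {a} {y} y<a with y ℕ.<? a
... | yes _ = refl
... | no y≮a = contradiction y<a y≮a

interval-above : ∀ {a y} → a ≤ y → interval a y ≡ Sign.-
interval-above {a} {y} a≤y with y ℕ.<? a
... | yes y<a = contradiction a≤y (ℕP.<⇒≱ y<a)
... | no _ = refl

module Interval (n : ℕ) .{{_ : NonZero n}} {a : ℕ} (a≤n : a ≤ n) where
  open Residues n
  open Correlation n (interval a) public

  ∑-interval : ∑< n g ≡ + 2 * + a - + n
  ∑-interval = begin
    ∑< n g                                       ≡⟨ cong (λ m → ∑< m g) (sym (ℕP.m+[n∸m]≡n a≤n)) ⟩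
    ∑< (a ℕ.+ (n ∸ a)) g                         ≡⟨ ∑<-split a (n ∸ a) g ⟩
    ∑< a g + ∑< (n ∸ a) (λ i → g (a ℕ.+ i))      ≡⟨ cong₂ _+_ (∑<-cong a below) (∑<-cong (n ∸ a) above) ⟩
    ∑< a (λ _ → + 1) + ∑< (n ∸ a) (λ _ → - + 1)  ≡⟨ cong₂ _+_ (∑<-const a (+ 1)) (∑<-const (n ∸ a) (- + 1)) ⟩
    + a * + 1 + + (n ∸ a) * - + 1                ≡⟨ count (+ a) (+ (n ∸ a)) ⟩
    + 2 * + a - (+ a + + (n ∸ a))                ≡⟨ cong (λ v → + 2 * + a - v) a+[n-a]≡n ⟩
    + 2 * + a - + n                              ∎
    where
    below : ∀ i → i < a → g i ≡ + 1
    below i i<a = cong sgn (trans (cong (interval a) (m<n⇒m%n≡m (ℕP.<-≤-trans i<a a≤n))) (interval-below i<a))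
    above : ∀ i → i < n ∸ a → g (a ℕ.+ i) ≡ - + 1
    above i i<n-a = cong sgn (trans (cong (interval a) (m<n⇒m%n≡m a+i<n)) (interval-above (ℕP.m≤m+n a i)))
      where
      a+i<n : a ℕ.+ i < n
      a+i<n = subst (a ℕ.+ i <_) (ℕP.m+[n∸m]≡n a≤n) (ℕP.+-monoʳ-< a i<n-a)
    count : ∀ A B → A * + 1 + B * - + 1 ≡ + 2 * A - (A + B)
    count = solve-∀
    a+[n-a]≡n : + a + + (n ∸ a) ≡ + n
    a+[n-a]≡n = cong +_ (ℕP.m+[n∸m]≡n a≤n)

  countPlus-dilate : ∀ {m} → Coprime n m → countPlus (dilate m) ≡ a
  countPlus-dilate {m} coprime = ℤP.+-injective (ℤP.*-cancelˡ-≡ (+ 2) _ _ (begin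
    + 2 * + countPlus (dilate m)    ≡⟨ sign-sum (dilate m) ⟩
    ∑< n (λ i → g (m ℕ.* i)) + + n  ≡⟨ cong (_+ + n) (trans (∑<-dilate coprime g-periodic) ∑-interval) ⟩
    + 2 * + a - + n + + n           ≡⟨ cancel (+ 2 * + a) (+ n) ⟩
    + 2 * + a                       ∎))
    where
    cancel : ∀ X N → X - N + N ≡ X
    cancel = solve-∀

odd-half : ∀ {n} → n % 2 ≡ 1 → n ≡ suc (n / 2 ℕ.+ n / 2)
odd-half {n} odd = begin
  n                      ≡⟨ m≡m%n+[m/n]*n n 2 ⟩
  n % 2 ℕ.+ n / 2 ℕ.* 2  ≡⟨ cong₂ ℕ._+_ odd (double (n / 2)) ⟩
  suc (n / 2 ℕ.+ n / 2)  ∎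
  where
  double : ∀ h → h ℕ.* 2 ≡ h ℕ.+ h
  double = ℕSolver.solve-∀

triangular : ∀ {n h} → n ≡ suc (h ℕ.+ h) → (n ℕ.* (n ∸ 1)) / 2 ≡ n ℕ.* h
triangular {h = h} refl = trans (cong (_/ 2) (twice h)) (m*n/n≡m (suc (h ℕ.+ h) ℕ.* h) 2)
  where
  twice : ∀ h → (1 ℕ.+ (h ℕ.+ h)) ℕ.* (h ℕ.+ h) ≡ (1 ℕ.+ (h ℕ.+ h)) ℕ.* h ℕ.* 2
  twice = ℕSolver.solve-∀

odd-square : ∀ A P H T → P ≡ + 1 + (H + H) → (+ 2 * A - P) * (+ 2 * A - P) ≡ P + (T + T) →
  T ≡ + 2 * A * (A - P) + P * H
odd-square A P H T refl square = ℤP.*-cancelˡ-≡ (+ 2) T (+ 2 * A * (A - P) + P * H) (begin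
  + 2 * T                            ≡⟨ isolate P T ⟩
  P + (T + T) - P                    ≡⟨ cong (_- P) (sym square) ⟩
  (+ 2 * A - P) * (+ 2 * A - P) - P  ≡⟨ expand A H ⟩
  + 2 * (+ 2 * A * (A - P) + P * H)  ∎)
  where
  isolate : ∀ P T → + 2 * T ≡ P + (T + T) - P
  isolate = solve-∀
  expand : ∀ A H →
    (+ 2 * A - (+ 1 + (H + H))) * (+ 2 * A - (+ 1 + (H + H))) - (+ 1 + (H + H))
      ≡ + 2 * (+ 2 * A * (A - (+ 1 + (H + H))) + (+ 1 + (H + H)) * H)
  expand = solve-∀

theorem10 : (p a : ℕ) → (pr : Prime p) → p % 2 ≡ 1 → 1 < a → a < p →
    Σ (Fin (p / 2) → PMSeq p) λ A →
      ((j : Fin (p / 2)) → countPlus (A j) ≡ a) ×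
      IsPComS p {{prime⇒nonZero pr}} (p / 2)
        ((ℤ.+ 2 ℤ.* ℤ.+ a ℤ.* (ℤ.+ a ℤ.- ℤ.+ p)) ℤ.+ ℤ.+ ((p ℕ.* (p ∸ 1)) / 2)) A
theorem10 p a pr podd _ a<p = family , counts , pcoms
  where
  instance
    p≢0 : NonZero p
    p≢0 = prime⇒nonZero pr
  h = p / 2
  p≡2h+1 : p ≡ suc (h ℕ.+ h)
  p≡2h+1 = odd-half podd
  open Interval p (ℕP.<⇒≤ a<p)

  unit : ∀ {m} → suc m < p → Coprime p (suc m)
  unit = prime⇒coprime pr

  multiplier<p : (j : Fin h) → suc (toℕ j) < p
  multiplier<p j = ℕP.≤-<-trans (toℕ<n j) (subst (h <_) (sym p≡2h+1) (ℕ.s≤s (ℕP.m≤m+n h h)))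

  family : Fin h → PMSeq p
  family j = dilate (suc (toℕ j))

  counts : (j : Fin h) → countPlus (family j) ≡ a
  counts j = countPlus-dilate (unit (multiplier<p j))

  -- ∑_j P_{A_j}(k) = ∑_j C(j·k) = T, and 2T + p = (∑ g)² = (2a - p)²
  pcoms : IsPComS p h (+ 2 * + a * (+ a - + p) + + ((p ℕ.* (p ∸ 1)) / 2)) family
  pcoms (suc k) _ 1+k≤p-1 = begin
    sumℤ (λ j → PAC p (family j) (suc k))              ≡⟨ sumℤ-cong (λ j → PAC-dilate (suc k) (unit (multiplier<p j))) ⟩
    T                                                  ≡⟨ odd-square (+ a) (+ p) (+ h) T (cong +_ p≡2h+1) square ⟩
    + 2 * + a * (+ a - + p) + + p * + h                ≡⟨ cong (λ v → + 2 * + a * (+ a - + p) + v) (sym p·h) ⟩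
    + 2 * + a * (+ a - + p) + + ((p ℕ.* (p ∸ 1)) / 2)  ∎
    where
    T = ∑< h (λ j → corr (suc j ℕ.* suc k))
    square : (+ 2 * + a - + p) * (+ 2 * + a - + p) ≡ + p + (T + T)
    square = trans (cong₂ _*_ (sym ∑-interval) (sym ∑-interval))
      (corr-half-sum {h} p≡2h+1 (unit (ℕP.m≤pred[n]⇒suc[m]≤n 1+k≤p-1)))
    p·h : + ((p ℕ.* (p ∸ 1)) / 2) ≡ + p * + h
    p·h = trans (cong +_ (triangular p≡2h+1)) (ℤP.pos-* p h)
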